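{- Let $\Sigma = \{A3, B1, B2, B3, B4, B5, B6, B7\}$ be the axiom system described in the context. Then $\Sigma \setminus \{B5\} \nvdash B5$; equivalently, the theory $(\Sigma \setminus \{B5\}) \cup \{\neg B5\}$ has a model.
   Context: Work in classical one-sorted first-order logic with equality, in the language with three constant symbols $a_0, a_1, a_2$, a ternary relation symbol $L$ (collinearity) and a ternary function symbol $\tau$. Write $\sigma(a,b)$ as an abbreviation for $\tau(b,a,a)$. The axioms below are understood as universally closed: A3: $a \ne b \wedge L(a,b,c) \wedge L(a,b,d) \rightarrow L(a,c,d)$; B1: $L(a,b,c) \rightarrow L(b,a,c)$; B2: $\tau(a,b,c) = \tau(a,c,b)$; B3: $L(a,b,\sigma(a,b))$; B4: $L(a,b,c) \rightarrow L(x, \tau(a,b,x), \tau(a,c,x))$; B5: $\tau(a,b,x) = x \rightarrow a = b$; B6: $\tau(a,b,x) = \tau(c, \tau(a,b,x), x)$; B7: $\neg L(a_0,a_1,a_2)$. $\Sigma$ is the set $\{A3,B1,B2,B3,B4,B5,B6,B7\}$. -}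

module Defs where

open import Data.Product using (Σ; _×_)
open import Relation.Nullary using (¬_)
open import Relation.Binary.PropositionalEquality using (_≡_; _≢_)

record Structure : Set₁ where
  field
    M  : Set
    a₀ a₁ a₂ : M
    L  : M → M → M → Set
    τ  : M → M → M → M

  σ : M → M → M
  σ a b = τ b a a

module Axioms (S : Structure) where
  open Structure S

  A3 : Set
  A3 = ∀ a b c d → a ≢ b → L a b c → L a b d → L a c d

  B1 : Set
  B1 = ∀ a b c → L a b c → L b a c

  B2 : Set
  B2 = ∀ a b c → τ a b c ≡ τ a c b

  B3 : Set
  B3 = ∀ a b → L a b (σ a b)

  B4 : Set
  B4 = ∀ a b c x → L a b c → L x (τ a b x) (τ a c x)

  B5 : Set
  B5 = ∀ a b x → τ a b x ≡ x → a ≡ b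

  B6 : Set
  B6 = ∀ a b c x → τ a b x ≡ τ c (τ a b x) x

  B7 : Set
  B7 = ¬ L a₀ a₁ a₂

ModelOfΣminusB5withNotB5 : Structure → Set
ModelOfΣminusB5withNotB5 S =
  A3 × B1 × B2 × B3 × B4 × B6 × B7 × ¬ B5
  where open Axioms S

-- Interpret τ(a,b,x) as "x if b = x, and a fixed point k otherwise" (ignoring a), and
-- L(a,b,c) as "a, b, c are not pairwise distinct", on a three-element set.  Then
-- τ(a,b,x) and τ(a,c,x) both lie in {x, k}, so together with x they repeat a point,
-- which gives B4; the other axioms except B5 are immediate.  B5 fails because
-- τ(a,x,x) = x for every a.
module Submission where

open import Defs
open import Data.Product using (Σ; _×_; _,_)
open import Data.Sum using (_⊎_; inj₁; inj₂)
open import Data.Fin using (Fin; zero; suc)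
open import Data.Fin.Properties using (_≟_)
open import Relation.Nullary using (¬_; yes; no; contradiction)
open import Relation.Nullary.Decidable using (decidable-stable)
open import Relation.Binary.Definitions using (DecidableEquality)
open import Relation.Binary.PropositionalEquality using (_≡_; _≢_; refl; sym; trans)

module Degeneracy {A : Set} (_≟ᴬ_ : DecidableEquality A) where

  Distinct : A → A → A → Set
  Distinct a b c = a ≢ b × b ≢ c × a ≢ c

  Degenerate : A → A → A → Set
  Degenerate a b c = ¬ Distinct a b c

  degenerate-swap : ∀ {a b c} → Degenerate a b c → Degenerate b a c
  degenerate-swap deg (b≢a , a≢c , b≢c) = deg ((λ a≡b → b≢a (sym a≡b)) , b≢c , a≢c)

  degenerate⇒≡ : ∀ {a b c} → a ≢ b → a ≢ c → Degenerate a b c → b ≡ c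
  degenerate⇒≡ {b = b} {c} a≢b a≢c deg =
    decidable-stable (b ≟ᴬ c) (λ b≢c → deg (a≢b , b≢c , a≢c))

  degenerate-pivot : ∀ {a b c d} → a ≢ b → Degenerate a b c → Degenerate a b d →
                     Degenerate a c d
  degenerate-pivot a≢b deg-c deg-d (a≢c , c≢d , a≢d) =
    c≢d (trans (sym (degenerate⇒≡ a≢b a≢c deg-c)) (degenerate⇒≡ a≢b a≢d deg-d))

  degenerate-within-pair : ∀ {x k u v} → u ≡ x ⊎ u ≡ k → v ≡ x ⊎ v ≡ k →
                           Degenerate x u v
  degenerate-within-pair (inj₁ u≡x) _          (x≢u , _ , _) = x≢u (sym u≡x)
  degenerate-within-pair (inj₂ u≡k) (inj₁ v≡x) (_ , _ , x≢v) = x≢v (sym v≡x)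
  degenerate-within-pair (inj₂ u≡k) (inj₂ v≡k) (_ , u≢v , _) = u≢v (trans u≡k (sym v≡k))

module Keep {A : Set} (_≟ᴬ_ : DecidableEquality A) (k : A) where

  keep : A → A → A
  keep y x with y ≟ᴬ x
  ... | yes _ = x
  ... | no  _ = k

  keep-comm : ∀ y x → keep y x ≡ keep x y
  keep-comm y x with y ≟ᴬ x | x ≟ᴬ y
  ... | yes y≡x | yes _   = sym y≡x
  ... | yes y≡x | no  x≢y = contradiction (sym y≡x) x≢y
  ... | no  y≢x | yes x≡y = contradiction (sym x≡y) y≢x
  ... | no  _   | no  _   = refl

  keep-self : ∀ x → keep x x ≡ x
  keep-self x with x ≟ᴬ x
  ... | yes _   = refl
  ... | no  x≢x = contradiction refl x≢x

  keep-≡⊎≡k : ∀ y x → keep y x ≡ x ⊎ keep y x ≡ k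
  keep-≡⊎≡k y x with y ≟ᴬ x
  ... | yes _ = inj₁ refl
  ... | no  _ = inj₂ refl

  keep-k : ∀ x → keep k x ≡ k
  keep-k x with k ≟ᴬ x
  ... | yes k≡x = sym k≡x
  ... | no  _   = refl

  keep-keep : ∀ y x → keep (keep y x) x ≡ keep y x
  keep-keep y x with y ≟ᴬ x
  ... | yes _ = keep-self x
  ... | no  _ = keep-k x

open Degeneracy (_≟_ {3})
open Keep (_≟_ {3}) zero

model : Structure
model = record
  { M = Fin 3 ; a₀ = zero ; a₁ = suc zero ; a₂ = suc (suc zero)
  ; L = Degenerate ; τ = λ _ b x → keep b x }

open Axioms model

proposition1 : Σ Structure ModelOfΣminusB5withNotB5
proposition1 = model , a3 , b1 , b2 , b3 , b4 , b6 , b7 , ¬b5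
  where
  a3 : A3
  a3 _ _ _ _ = degenerate-pivot

  b1 : B1
  b1 _ _ _ = degenerate-swap

  b2 : B2
  b2 _ = keep-comm

  b3 : B3
  b3 a _ (_ , _ , a≢σ) = a≢σ (sym (keep-self a))

  b4 : B4
  b4 _ b c x _ = degenerate-within-pair (keep-≡⊎≡k b x) (keep-≡⊎≡k c x)

  b6 : B6
  b6 _ b _ x = sym (keep-keep b x)

  b7 : B7
  b7 deg = deg ((λ ()) , (λ ()) , (λ ()))

  ¬b5 : ¬ B5
  ¬b5 b5 with b5 zero (suc zero) (suc zero) (keep-self (suc zero))
  ... | ()
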